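{- Let $k\ge1$, $a\ge2$, let $R=\{v_1,\ldots,v_n\}$ be a non-empty set of vertices of the Hamming graph $\mathbb{H}_{k,a}$, and let $A$ be the $n\times ak$ matrix whose $i$-th row is $\mathrm{vec}(V_i)$, where $V_i$ is the one-hot encoding of $v_i$. Let $$\mathcal{I}:=\bigcap_{i=1}^k\Big\{z\in\mathbb{Z}^{ak} : \sum_{j=(i-1)a+1}^{ia}z_j=0\ \text{and}\ \sum_{j=(i-1)a+1}^{ia}|z_j|\le 2\Big\}.$$ Then $R$ is not a resolving set of $\mathbb{H}_{k,a}$ if and only if the optimal value of the integer linear program $$\min_{z\in\mathbb{R}^{ak}}\ \sum_{j=1}^{ak}2^j z_j\quad\text{subject to}\quad Az=0\ \text{and}\ z\in\mathcal{I}$$ is less than zero.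
   Context: The Hamming graph $\mathbb{H}_{k,a}$ has vertex set $\{0,\ldots,a-1\}^k$ ($k$-mers), two vertices adjacent iff they differ in exactly one coordinate; its graph distance is the Hamming distance $d(u,v)$ (number of coordinates where $u,v$ differ). A non-empty vertex set $R$ is resolving if for all vertices $u\ne v$ there is $r\in R$ with $d(u,r)\ne d(v,r)$. The one-hot encoding of a $k$-mer $v$ is the $a\times k$ binary matrix $V$ with $V[i,j]=1$ iff $i-1=v[j]$. $\mathrm{vec}(C)$ is the row vector obtained by concatenating the columns of $C$ from left to right (column-major ordering). -}

module Defs where

open import Data.Nat using (ℕ; zero; suc; _≤_)
open import Data.Fin using (Fin; zero; suc; toℕ; remQuot)
open import Data.Vec using (Vec; []; _∷_; lookup)
open import Data.Integer as ℤ using (ℤ; +_; ∣_∣)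
open import Data.Product using (Σ; _×_; _,_; ∃-syntax)
open import Data.Sum using (_⊎_)
open import Relation.Binary.PropositionalEquality using (_≡_; _≢_)
open import Relation.Nullary using (¬_; yes; no)
open import Data.Fin.Properties using () renaming (_≟_ to _≟ᶠ_)
import Data.Nat as ℕ

Vertex : ℕ → ℕ → Set
Vertex k a = Vec (Fin a) k

hamming : ∀ {k a} → Vertex k a → Vertex k a → ℕ
hamming [] [] = 0
hamming (x ∷ u) (y ∷ v) with x ≟ᶠ y
... | yes _ = hamming u v
... | no  _ = suc (hamming u v)

Resolving : ∀ {k a n} → (Fin n → Vertex k a) → Set
Resolving {k} {a} {n} R =
  (u v : Vertex k a) → u ≢ v → ∃[ i ] (hamming u (R i) ≢ hamming v (R i))

∑ℤ : ∀ {n} → (Fin n → ℤ) → ℤ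
∑ℤ {zero} f = + 0
∑ℤ {suc n} f = f zero ℤ.+ ∑ℤ (λ i → f (suc i))

∑ℕ : ∀ {n} → (Fin n → ℕ) → ℕ
∑ℕ {zero} f = 0
∑ℕ {suc n} f = f zero ℕ.+ ∑ℕ (λ i → f (suc i))

oneHot : ∀ {k a} → Vertex k a → Fin a → Fin k → ℤ
oneHot v l c with l ≟ᶠ lookup v c
... | yes _ = + 1
... | no  _ = + 0

-- Column-major vectorisation of an a×k matrix: entry (c·a + l) is C[l,c].
vec : ∀ {k a} → (Fin a → Fin k → ℤ) → Fin (k ℕ.* a) → ℤ
vec {k} {a} C j with remQuot {k} a j
... | c , l = C l c

rowMatrix : ∀ {k a n} → (Fin n → Vertex k a) → Fin n → Fin (k ℕ.* a) → ℤ
rowMatrix R i = vec (oneHot (R i))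

blockIdx : ∀ {k a} → Fin k → Fin a → Fin (k ℕ.* a)
blockIdx {k} {a} c l = Data.Fin.combine c l

InI : ∀ {k a} → (Fin (k ℕ.* a) → ℤ) → Set
InI {k} {a} z = (c : Fin k) →
  (∑ℤ (λ l → z (blockIdx {k} {a} c l)) ≡ + 0) ×
  (∑ℕ (λ l → ∣ z (blockIdx {k} {a} c l) ∣) ≤ 2)

Feasible : ∀ {k a n} → (Fin n → Vertex k a) → (Fin (k ℕ.* a) → ℤ) → Set
Feasible {k} {a} R z =
  ((i : _) → ∑ℤ (λ j → rowMatrix R i j ℤ.* z j) ≡ + 0) × InI {k} {a} z

-- Objective: ∑_{j=1}^{ak} 2^j z_j (1-based j, so the Fin index j has weight 2^(j+1)).
objective : ∀ {m} → (Fin m → ℤ) → ℤ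
objective z = ∑ℤ (λ j → (+ (2 ℕ.^ suc (toℕ j))) ℤ.* z j)

IsOptimalValue : ∀ {k a n} → (Fin n → Vertex k a) → ℤ → Set
IsOptimalValue {k} {a} R m =
  (∃[ z ] (Feasible R z × objective z ≡ m)) ×
  ((z : Fin (k ℕ.* a) → ℤ) → Feasible R z → m ℤ.≤ objective z)

{-# OPTIONS --safe #-}
-- Each block of a point of 𝓘 has sum 0 and ℓ¹-norm at most 2, so it is a difference e_x − e_y
-- of unit vectors: the points of 𝓘 are exactly the vectors vec(U − V) for vertices u, v.
-- Row i of A sends vec(U − V) to (#coordinates where v_i agrees with u) − (same for v),
-- which is d(v, v_i) − d(u, v_i); so vec(U − V) is feasible iff u and v are equidistant
-- from every v_i. Its entries lie in {−1, 0, 1}, and a signed binary expansion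
-- ∑ 2^j z_j of 0 with such digits is trivial, so the objective vanishes only when u = v.
-- Hence u ≠ v not resolved by R give feasible points vec(U − V) and vec(V − U) with opposite
-- nonzero objectives, and the optimum (a minimum over finitely many vertex pairs) is negative;
-- conversely a feasible point of negative objective exhibits such a pair u ≠ v.
module Submission where

open import Defs
open import Data.Nat using (ℕ; _≤_)
open import Data.Fin using (Fin)
open import Data.Integer using (ℤ; _<_; +_)
open import Data.Product using (_×_; ∃-syntax)
open import Function.Bundles using (_⇔_)
open import Relation.Nullary using (¬_)

open import Data.Nat as ℕ using (zero; suc; z≤n; s≤s)
import Data.Nat.Properties as ℕP
open import Data.Fin using (zero; suc; toℕ; combine; remQuot; _↑ˡ_; _↑ʳ_)
import Data.Fin.Properties as FinP
open import Data.Vec using (Vec; []; _∷_; lookup; tabulate)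
open import Data.Vec.Properties using (lookup∘tabulate; ≡-dec)
open import Data.Integer as ℤ using (_+_; _*_; _-_; -_; ∣_∣; -[1+_])
import Data.Integer.Properties as ℤP
open import Data.Integer.Tactic.RingSolver using (solve-∀)
open import Algebra.Properties.AbelianGroup ℤP.+-0-abelianGroup
  using (⁻¹-anti-homo‿-; inverseˡ-unique; inverseʳ-unique)
open import Algebra.Properties.CommutativeSemigroup ℤP.+-commutativeSemigroup
  using (interchange; x∙yz≈y∙xz)
open import Algebra.Properties.CommutativeSemigroup ℕP.+-commutativeSemigroup
  using () renaming (interchange to ℕ-interchange)
open import Data.Product using (Σ-syntax; ∃₂; _,_; proj₁; proj₂)
open import Data.Vec.Relation.Binary.Pointwise.Extensional using (ext; Pointwise-≡⇒≡)
open import Data.Empty using (⊥-elim)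
open import Function using (_∘_)
open import Function.Bundles using (mk⇔; Equivalence)
open import Relation.Nullary using (yes; no; Dec)
open import Relation.Binary.PropositionalEquality
open ≡-Reasoning

∑ℤ-cong : ∀ {n} {f g : Fin n → ℤ} → f ≗ g → ∑ℤ f ≡ ∑ℤ g
∑ℤ-cong {zero}  f≗g = refl
∑ℤ-cong {suc n} f≗g = cong₂ _+_ (f≗g zero) (∑ℤ-cong (f≗g ∘ suc))

∑ℤ-zero : ∀ {n} {f : Fin n → ℤ} → (∀ i → f i ≡ + 0) → ∑ℤ f ≡ + 0
∑ℤ-zero {zero}  f≗0 = refl
∑ℤ-zero {suc n} f≗0 = cong₂ _+_ (f≗0 zero) (∑ℤ-zero (f≗0 ∘ suc))

∑ℤ-distrib-+ : ∀ {n} (f g : Fin n → ℤ) → ∑ℤ (λ i → f i + g i) ≡ ∑ℤ f + ∑ℤ g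
∑ℤ-distrib-+ {zero}  f g = refl
∑ℤ-distrib-+ {suc n} f g = trans
  (cong (_+_ (f zero + g zero)) (∑ℤ-distrib-+ (f ∘ suc) (g ∘ suc)))
  (interchange (f zero) (g zero) _ _)

∑ℤ-scale : ∀ {n} (c : ℤ) (f : Fin n → ℤ) → ∑ℤ (λ i → c * f i) ≡ c * ∑ℤ f
∑ℤ-scale {zero}  c f = sym (ℤP.*-zeroʳ c)
∑ℤ-scale {suc n} c f = trans
  (cong (_+_ (c * f zero)) (∑ℤ-scale c (f ∘ suc)))
  (sym (ℤP.*-distribˡ-+ c (f zero) _))

∑ℤ-neg : ∀ {n} (f : Fin n → ℤ) → ∑ℤ (λ i → - f i) ≡ - ∑ℤ f
∑ℤ-neg {zero}  f = refl
∑ℤ-neg {suc n} f = trans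
  (cong (_+_ (- f zero)) (∑ℤ-neg (f ∘ suc)))
  (sym (ℤP.neg-distrib-+ (f zero) _))

∑ℤ-sub : ∀ {n} (f g : Fin n → ℤ) → ∑ℤ (λ i → f i - g i) ≡ ∑ℤ f - ∑ℤ g
∑ℤ-sub f g = trans (∑ℤ-distrib-+ f (-_ ∘ g)) (cong (_+_ (∑ℤ f)) (∑ℤ-neg g))

∑ℤ-splitAt : ∀ m {n} (f : Fin (m ℕ.+ n) → ℤ) →
             ∑ℤ f ≡ ∑ℤ (f ∘ (_↑ˡ n)) + ∑ℤ (f ∘ (m ↑ʳ_))
∑ℤ-splitAt zero    f = sym (ℤP.+-identityˡ _)
∑ℤ-splitAt (suc m) f = trans
  (cong (_+_ (f zero)) (∑ℤ-splitAt m (f ∘ suc)))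
  (sym (ℤP.+-assoc (f zero) _ _))

∑ℤ-combine : ∀ k {a} (f : Fin (k ℕ.* a) → ℤ) →
             ∑ℤ f ≡ ∑ℤ (λ c → ∑ℤ (λ l → f (combine {k} {a} c l)))
∑ℤ-combine zero    f = refl
∑ℤ-combine (suc k) {a} f = trans
  (∑ℤ-splitAt a f)
  (cong (_+_ (∑ℤ (f ∘ (_↑ˡ (k ℕ.* a))))) (∑ℤ-combine k (f ∘ (a ↑ʳ_))))

∑ℕ-cong : ∀ {n} {f g : Fin n → ℕ} → f ≗ g → ∑ℕ f ≡ ∑ℕ g
∑ℕ-cong {zero}  f≗g = refl
∑ℕ-cong {suc n} f≗g = cong₂ ℕ._+_ (f≗g zero) (∑ℕ-cong (f≗g ∘ suc))

∑ℕ-zero : ∀ {n} {f : Fin n → ℕ} → (∀ i → f i ≡ 0) → ∑ℕ f ≡ 0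
∑ℕ-zero {zero}  f≗0 = refl
∑ℕ-zero {suc n} f≗0 = cong₂ ℕ._+_ (f≗0 zero) (∑ℕ-zero (f≗0 ∘ suc))

∑ℕ-mono-≤ : ∀ {n} {f g : Fin n → ℕ} → (∀ i → f i ≤ g i) → ∑ℕ f ≤ ∑ℕ g
∑ℕ-mono-≤ {zero}  f≤g = z≤n
∑ℕ-mono-≤ {suc n} f≤g = ℕP.+-mono-≤ (f≤g zero) (∑ℕ-mono-≤ (f≤g ∘ suc))

∑ℕ-distrib-+ : ∀ {n} (f g : Fin n → ℕ) → ∑ℕ (λ i → f i ℕ.+ g i) ≡ ∑ℕ f ℕ.+ ∑ℕ g
∑ℕ-distrib-+ {zero}  f g = refl
∑ℕ-distrib-+ {suc n} f g = trans
  (cong ((f zero ℕ.+ g zero) ℕ.+_) (∑ℕ-distrib-+ (f ∘ suc) (g ∘ suc)))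
  (ℕ-interchange (f zero) (g zero) _ _)

∑ℕ≤0⇒≡0 : ∀ {n} (f : Fin n → ℕ) → ∑ℕ f ≤ 0 → ∀ i → f i ≡ 0
∑ℕ≤0⇒≡0 f ∑f≤0 zero    = ℕP.n≤0⇒n≡0 (ℕP.m+n≤o⇒m≤o (f zero) ∑f≤0)
∑ℕ≤0⇒≡0 f ∑f≤0 (suc i) = ∑ℕ≤0⇒≡0 (f ∘ suc) (ℕP.m+n≤o⇒n≤o (f zero) ∑f≤0) i

∑∣∣≤0⇒x+∑≡x : ∀ {n} x (f : Fin n → ℤ) → ∑ℕ (∣_∣ ∘ f) ≤ 0 → x + ∑ℤ f ≡ x
∑∣∣≤0⇒x+∑≡x x f ∑∣f∣≤0 = trans
  (cong (_+_ x) (∑ℤ-zero (ℤP.∣i∣≡0⇒i≡0 ∘ ∑ℕ≤0⇒≡0 (∣_∣ ∘ f) ∑∣f∣≤0)))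
  (ℤP.+-identityʳ x)

δ : ∀ {a} → Fin a → Fin a → ℤ
δ l x with l FinP.≟ x
... | yes _ = + 1
... | no  _ = + 0

δ-≡ : ∀ {a} {l x : Fin a} → l ≡ x → δ l x ≡ + 1
δ-≡ {l = l} {x} l≡x with l FinP.≟ x
... | yes _   = refl
... | no  l≢x = ⊥-elim (l≢x l≡x)

δ-≢ : ∀ {a} {l x : Fin a} → l ≢ x → δ l x ≡ + 0
δ-≢ {l = l} {x} l≢x with l FinP.≟ x
... | yes l≡x = ⊥-elim (l≢x l≡x)
... | no  _   = refl

δ-suc : ∀ {a} (l x : Fin a) → δ (suc l) (suc x) ≡ δ l x
δ-suc l x with l FinP.≟ x
... | yes _ = refl
... | no  _ = refl

∑-δ : ∀ {a} (x : Fin a) (h : Fin a → ℤ) → ∑ℤ (λ l → δ l x * h l) ≡ h x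
∑-δ {suc a} zero h = begin
  + 1 * h zero + ∑ℤ (λ l → δ (suc l) zero * h (suc l))
    ≡⟨ cong₂ _+_ (ℤP.*-identityˡ (h zero)) (∑ℤ-zero {a} λ _ → refl) ⟩
  h zero + + 0
    ≡⟨ ℤP.+-identityʳ (h zero) ⟩
  h zero
    ∎
∑-δ (suc x) h = begin
  + 0 * h zero + ∑ℤ (λ l → δ (suc l) (suc x) * h (suc l))
    ≡⟨ ℤP.+-identityˡ _ ⟩
  ∑ℤ (λ l → δ (suc l) (suc x) * h (suc l))
    ≡⟨ ∑ℤ-cong (λ l → cong (_* h (suc l)) (δ-suc l x)) ⟩
  ∑ℤ (λ l → δ l x * h (suc l))
    ≡⟨ ∑-δ x (h ∘ suc) ⟩
  h (suc x)
    ∎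

∑δ : ∀ {a} (x : Fin a) → ∑ℤ (λ l → δ l x) ≡ + 1
∑δ x = trans (∑ℤ-cong (λ l → sym (ℤP.*-identityʳ (δ l x)))) (∑-δ x (λ _ → + 1))

∑∣δ∣ : ∀ {a} (x : Fin a) → ∑ℕ (λ l → ∣ δ l x ∣) ≡ 1
∑∣δ∣ {suc a} zero = cong suc (∑ℕ-zero {a} λ _ → refl)
∑∣δ∣ (suc x)      = trans (∑ℕ-cong (λ l → cong ∣_∣ (δ-suc l x))) (∑∣δ∣ x)

oneHot≡δ : ∀ {k a} (v : Vertex k a) l c → oneHot v l c ≡ δ l (lookup v c)
oneHot≡δ v l c with l FinP.≟ lookup v c
... | yes _ = refl
... | no  _ = refl

∣oneHot-oneHot∣≤1 : ∀ {k a} (u v : Vertex k a) l c → ∣ oneHot u l c - oneHot v l c ∣ ≤ 1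
∣oneHot-oneHot∣≤1 u v l c with l FinP.≟ lookup u c | l FinP.≟ lookup v c
... | yes _ | yes _ = z≤n
... | yes _ | no  _ = s≤s z≤n
... | no  _ | yes _ = s≤s z≤n
... | no  _ | no  _ = z≤n

vec-combine : ∀ {k a} (C : Fin a → Fin k → ℤ) c l → vec C (combine c l) ≡ C l c
vec-combine C c l = cong (λ (c′ , l′) → C l′ c′) (FinP.remQuot-combine c l)

diff : ∀ {k a} → Vertex k a → Vertex k a → Fin (k ℕ.* a) → ℤ
diff u v = vec (λ l c → oneHot u l c - oneHot v l c)

diff-combine : ∀ {k a} (u v : Vertex k a) c l →
               diff u v (combine c l) ≡ δ l (lookup u c) - δ l (lookup v c)
diff-combine u v c l = trans
  (vec-combine (λ l c → oneHot u l c - oneHot v l c) c l)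
  (cong₂ _-_ (oneHot≡δ u l c) (oneHot≡δ v l c))

diff-self : ∀ {k a} (u : Vertex k a) j → diff u u j ≡ + 0
diff-self {k} {a} u j = let (c , l) = remQuot {k} a j in ℤP.+-inverseʳ (oneHot u l c)

diff-swap : ∀ {k a} (u v : Vertex k a) j → diff v u j ≡ - diff u v j
diff-swap {k} {a} u v j = let (c , l) = remQuot {k} a j in
  sym (⁻¹-anti-homo‿- (oneHot u l c) (oneHot v l c))

∣diff∣≤1 : ∀ {k a} (u v : Vertex k a) j → ∣ diff u v j ∣ ≤ 1
∣diff∣≤1 {k} {a} u v j = let (c , l) = remQuot {k} a j in ∣oneHot-oneHot∣≤1 u v l c

diff≡0⇒≡ : ∀ {k a} (u v : Vertex k a) → (∀ j → diff u v j ≡ + 0) → u ≡ v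
diff≡0⇒≡ u v diff≡0 = Pointwise-≡⇒≡ (ext agree)
  where
  agree : ∀ c → lookup u c ≡ lookup v c
  agree c with lookup u c FinP.≟ lookup v c
  ... | yes uc≡vc = uc≡vc
  ... | no  uc≢vc = ⊥-elim (1≢0 (begin
    + 1
      ≡⟨ cong₂ _-_ (δ-≡ {l = lookup u c} refl) (δ-≢ uc≢vc) ⟨
    δ (lookup u c) (lookup u c) - δ (lookup u c) (lookup v c)
      ≡⟨ diff-combine u v c (lookup u c) ⟨
    diff u v (combine c (lookup u c))
      ≡⟨ diff≡0 _ ⟩
    + 0
      ∎))
    where
    1≢0 : + 1 ≢ + 0
    1≢0 ()

agreements : ∀ {k a} → Vertex k a → Vertex k a → ℤ
agreements w u = ∑ℤ (λ c → δ (lookup w c) (lookup u c))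

agreements+hamming : ∀ {k a} (u w : Vertex k a) → agreements w u + + hamming u w ≡ + k
agreements+hamming []      []      = refl
agreements+hamming {suc k} (x ∷ u) (y ∷ w) with x FinP.≟ y
... | yes x≡y = begin
  (δ y x + agreements w u) + + hamming u w
    ≡⟨ cong (λ t → t + agreements w u + + hamming u w) (δ-≡ (sym x≡y)) ⟩
  (+ 1 + agreements w u) + + hamming u w
    ≡⟨ ℤP.+-assoc (+ 1) (agreements w u) _ ⟩
  + 1 + (agreements w u + + hamming u w)
    ≡⟨ cong (_+_ (+ 1)) (agreements+hamming u w) ⟩
  + 1 + + k
    ∎
... | no x≢y = begin
  (δ y x + agreements w u) + (+ 1 + + hamming u w)
    ≡⟨ cong (λ t → t + agreements w u + (+ 1 + + hamming u w)) (δ-≢ (x≢y ∘ sym)) ⟩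
  (+ 0 + agreements w u) + (+ 1 + + hamming u w)
    ≡⟨ cong (_+ (+ 1 + + hamming u w)) (ℤP.+-identityˡ (agreements w u)) ⟩
  agreements w u + (+ 1 + + hamming u w)
    ≡⟨ x∙yz≈y∙xz (agreements w u) (+ 1) _ ⟩
  + 1 + (agreements w u + + hamming u w)
    ≡⟨ cong (_+_ (+ 1)) (agreements+hamming u w) ⟩
  + 1 + + k
    ∎

sub-of-complements : ∀ X Y p q {K : ℤ} → X + p ≡ K → Y + q ≡ K → X - Y ≡ q - p
sub-of-complements X Y p q {K} X+p≡K Y+q≡K = begin
  X - Y                         ≡⟨ rearrange X Y p q ⟩
  ((X + p) - (Y + q)) + (q - p) ≡⟨ cong₂ (λ s t → (s - t) + (q - p)) X+p≡K Y+q≡K ⟩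
  (K - K) + (q - p)             ≡⟨ cong (_+ (q - p)) (ℤP.+-inverseʳ K) ⟩
  + 0 + (q - p)                 ≡⟨ ℤP.+-identityˡ (q - p) ⟩
  q - p                         ∎
  where
  rearrange : ∀ X Y p q → X - Y ≡ ((X + p) - (Y + q)) + (q - p)
  rearrange = solve-∀

row·diff : ∀ {k a} (w u v : Vertex k a) →
           ∑ℤ (λ j → vec (oneHot w) j * diff u v j) ≡ + hamming v w - + hamming u w
row·diff {k} {a} w u v = begin
  ∑ℤ (λ j → vec (oneHot w) j * diff u v j)
    ≡⟨ ∑ℤ-combine k _ ⟩
  ∑ℤ (λ (c : Fin k) → ∑ℤ (λ (l : Fin a) → vec (oneHot w) (combine c l) * diff u v (combine c l)))
    ≡⟨ ∑ℤ-cong (λ c → ∑ℤ-cong (λ l → cong₂ _*_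
         (trans (vec-combine (oneHot w) c l) (oneHot≡δ w l c)) (diff-combine u v c l))) ⟩
  ∑ℤ (λ c → ∑ℤ (λ l → δ l (lookup w c) * (δ l (lookup u c) - δ l (lookup v c))))
    ≡⟨ ∑ℤ-cong (λ c → ∑-δ (lookup w c) _) ⟩
  ∑ℤ (λ c → δ (lookup w c) (lookup u c) - δ (lookup w c) (lookup v c))
    ≡⟨ ∑ℤ-sub (λ c → δ (lookup w c) (lookup u c)) (λ c → δ (lookup w c) (lookup v c)) ⟩
  agreements w u - agreements w v
    ≡⟨ sub-of-complements (agreements w u) (agreements w v) (+ hamming u w) (+ hamming v w)
         (agreements+hamming u w) (agreements+hamming v w) ⟩
  + hamming v w - + hamming u w
    ∎

row·diff≡0⇔ : ∀ {k a} (w u v : Vertex k a) →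
              (∑ℤ (λ j → vec (oneHot w) j * diff u v j) ≡ + 0) ⇔ (hamming u w ≡ hamming v w)
row·diff≡0⇔ w u v = mk⇔
  (λ row≡0 → sym (ℤP.+-injective (ℤP.i-j≡0⇒i≡j _ _ (trans (sym (row·diff w u v)) row≡0))))
  (λ d≡d → trans (row·diff w u v) (ℤP.i≡j⇒i-j≡0 (cong +_ (sym d≡d))))

Equidistant : ∀ {k a n} → (Fin n → Vertex k a) → Vertex k a → Vertex k a → Set
Equidistant R u v = ∀ i → hamming u (R i) ≡ hamming v (R i)

diff-InI : ∀ {k a} (u v : Vertex k a) → InI {k} {a} (diff u v)
diff-InI {a = a} u v c = block-sum , block-norm
  where
  x y : Fin a
  x = lookup u c
  y = lookup v c
  block-sum : ∑ℤ (λ l → diff u v (combine c l)) ≡ + 0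
  block-sum = begin
    ∑ℤ (λ l → diff u v (combine c l))   ≡⟨ ∑ℤ-cong (diff-combine u v c) ⟩
    ∑ℤ (λ l → δ l x - δ l y)            ≡⟨ ∑ℤ-sub (λ l → δ l x) (λ l → δ l y) ⟩
    ∑ℤ (λ l → δ l x) - ∑ℤ (λ l → δ l y) ≡⟨ cong₂ _-_ (∑δ x) (∑δ y) ⟩
    + 0                                 ∎
  block-norm : ∑ℕ (λ l → ∣ diff u v (combine c l) ∣) ≤ 2
  block-norm = ℕP.≤-trans (∑ℕ-mono-≤ triangle) (ℕP.≤-reflexive (trans
    (∑ℕ-distrib-+ (λ l → ∣ δ l x ∣) (λ l → ∣ δ l y ∣))
    (cong₂ ℕ._+_ (∑∣δ∣ x) (∑∣δ∣ y))))
    where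
    triangle : ∀ l → ∣ diff u v (combine c l) ∣ ≤ ∣ δ l x ∣ ℕ.+ ∣ δ l y ∣
    triangle l = subst (λ t → ∣ t ∣ ≤ ∣ δ l x ∣ ℕ.+ ∣ δ l y ∣)
      (sym (diff-combine u v c l)) (ℤP.∣i-j∣≤∣i∣+∣j∣ (δ l x) (δ l y))

Feasible-resp-≗ : ∀ {k a n} (R : Fin n → Vertex k a) {z z′ : Fin (k ℕ.* a) → ℤ} →
                  z ≗ z′ → Feasible R z → Feasible R z′
Feasible-resp-≗ {k} {a} R z≗z′ (rows , z∈I) =
  (λ i → trans (∑ℤ-cong (λ j → cong (rowMatrix R i j *_) (sym (z≗z′ j)))) (rows i)) ,
  (λ c → trans (∑ℤ-cong (λ l → sym (z≗z′ (blockIdx {k} {a} c l)))) (proj₁ (z∈I c)) ,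
         subst (_≤ 2) (∑ℕ-cong (λ l → cong ∣_∣ (z≗z′ (blockIdx {k} {a} c l)))) (proj₂ (z∈I c)))

diff-feasible⇔equidistant : ∀ {k a n} (R : Fin n → Vertex k a) u v →
                            Feasible R (diff u v) ⇔ Equidistant R u v
diff-feasible⇔equidistant R u v = mk⇔
  (λ (rows , _) i → Equivalence.to (row·diff≡0⇔ (R i) u v) (rows i))
  (λ eq → (λ i → Equivalence.from (row·diff≡0⇔ (R i) u v) (eq i)) , diff-InI u v)

unit-vector : ∀ {m} (f : Fin m → ℤ) → ∑ℤ f ≡ + 1 → ∑ℕ (∣_∣ ∘ f) ≤ 1 →
              ∃[ y ] (∀ l → f l ≡ δ l y)
unit-vector {suc m} f ∑f≡1 ∑∣f∣≤1 with f zero in f₀≡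
... | + 0 =
  let y , f≗δy = unit-vector (f ∘ suc) (trans (sym (ℤP.+-identityˡ _)) ∑f≡1) ∑∣f∣≤1
  in suc y , λ { zero → f₀≡ ; (suc l) → trans (f≗δy l) (sym (δ-suc l y)) }
unit-vector {suc m} f ∑f≡1 (s≤s ∑∣f∣≤0) | + 1 =
  zero , λ { zero → f₀≡ ; (suc l) → ℤP.∣i∣≡0⇒i≡0 (∑ℕ≤0⇒≡0 (∣_∣ ∘ f ∘ suc) ∑∣f∣≤0 l) }
unit-vector {suc m} f ∑f≡1 (s≤s ()) | + suc (suc n)
unit-vector {suc m} f ∑f≡1 (s≤s ∑∣f∣≤0) | -[1+ n ]
  with () ← trans (sym (∑∣∣≤0⇒x+∑≡x -[1+ n ] (f ∘ suc) (ℕP.m+n≤o⇒n≤o n ∑∣f∣≤0))) ∑f≡1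

negated-unit-vector : ∀ {m} (f : Fin m → ℤ) → ∑ℤ f ≡ -[1+ 0 ] → ∑ℕ (∣_∣ ∘ f) ≤ 1 →
                      ∃[ y ] (∀ l → f l ≡ - δ l y)
negated-unit-vector f ∑f≡-1 ∑∣f∣≤1 =
  let y , -f≗δy = unit-vector (-_ ∘ f) (trans (∑ℤ-neg f) (cong -_ ∑f≡-1))
                    (subst (_≤ 1) (∑ℕ-cong (λ l → sym (ℤP.∣-i∣≡∣i∣ (f l)))) ∑∣f∣≤1)
  in y , λ l → trans (sym (ℤP.neg-involutive (f l))) (cong -_ (-f≗δy l))

unit-difference : ∀ {m} (f : Fin (suc m) → ℤ) → ∑ℤ f ≡ + 0 → ∑ℕ (∣_∣ ∘ f) ≤ 2 →
                  ∃₂ λ x y → ∀ l → f l ≡ δ l x - δ l y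
unit-difference {zero} f ∑f≡0 _ =
  zero , zero , λ { zero → trans (sym (ℤP.+-identityʳ (f zero))) ∑f≡0 }
unit-difference {suc m} f ∑f≡0 ∑∣f∣≤2 with f zero in f₀≡
... | + 0 =
  let x , y , p = unit-difference (f ∘ suc) (trans (sym (ℤP.+-identityˡ _)) ∑f≡0) ∑∣f∣≤2
  in suc x , suc y , λ
    { zero → f₀≡
    ; (suc l) → trans (p l) (sym (cong₂ _-_ (δ-suc l x) (δ-suc l y))) }
unit-difference {suc m} f ∑f≡0 (s≤s ∑∣f∣≤1) | + 1 =
  let y , p = negated-unit-vector (f ∘ suc) (inverseʳ-unique (+ 1) _ ∑f≡0) ∑∣f∣≤1
  in zero , suc y , λ
    { zero → f₀≡
    ; (suc l) → trans (p l) (sym (trans (ℤP.+-identityˡ _) (cong -_ (δ-suc l y)))) }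
unit-difference {suc m} f ∑f≡0 (s≤s ∑∣f∣≤1) | -[1+ 0 ] =
  let x , p = unit-vector (f ∘ suc) (inverseʳ-unique -[1+ 0 ] _ ∑f≡0) ∑∣f∣≤1
  in suc x , zero , λ
    { zero → f₀≡
    ; (suc l) → trans (p l) (sym (trans (ℤP.+-identityʳ _) (δ-suc l x))) }
unit-difference {suc m} f ∑f≡0 (s≤s (s≤s ∑∣f∣≤0)) | + suc (suc n)
  with () ← trans (sym (∑∣∣≤0⇒x+∑≡x (+ suc (suc n)) (f ∘ suc) (ℕP.m+n≤o⇒n≤o n ∑∣f∣≤0))) ∑f≡0
unit-difference {suc m} f ∑f≡0 (s≤s (s≤s ∑∣f∣≤0)) | -[1+ suc n ]
  with () ← trans (sym (∑∣∣≤0⇒x+∑≡x -[1+ suc n ] (f ∘ suc) (ℕP.m+n≤o⇒n≤o n ∑∣f∣≤0))) ∑f≡0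

≗-by-blocks : ∀ {k a} {f g : Fin (k ℕ.* a) → ℤ} →
              (∀ c l → f (combine c l) ≡ g (combine c l)) → f ≗ g
≗-by-blocks {k} {a} f≗g j with FinP.combine-surjective {k} {a} j
... | c , l , refl = f≗g c l

InI⇒diff : ∀ {k a} (z : Fin (k ℕ.* suc a) → ℤ) → InI {k} {suc a} z →
           ∃₂ λ u v → z ≗ diff u v
InI⇒diff {k} {a} z z∈I = u , v , ≗-by-blocks z≗diff
  where
  block : ∀ c → ∃₂ λ x y → ∀ l → z (combine c l) ≡ δ l x - δ l y
  block c = unit-difference (λ l → z (combine c l)) (proj₁ (z∈I c)) (proj₂ (z∈I c))
  u = tabulate (proj₁ ∘ block)
  v = tabulate (proj₁ ∘ proj₂ ∘ block)
  z≗diff : ∀ c l → z (combine c l) ≡ diff u v (combine c l)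
  z≗diff c l = trans (proj₂ (proj₂ (block c)) l) (sym (trans (diff-combine u v c l)
    (cong₂ (λ x y → δ l x - δ l y) (lookup∘tabulate _ c) (lookup∘tabulate _ c))))

objective-cong : ∀ {m} {z z′ : Fin m → ℤ} → z ≗ z′ → objective z ≡ objective z′
objective-cong z≗z′ = ∑ℤ-cong (λ j → cong (λ t → + (2 ℕ.^ suc (toℕ j)) * t) (z≗z′ j))

objective-zero : ∀ {m} {z : Fin m → ℤ} → (∀ j → z j ≡ + 0) → objective z ≡ + 0
objective-zero z≗0 = ∑ℤ-zero (λ j → trans
  (cong (λ t → + (2 ℕ.^ suc (toℕ j)) * t) (z≗0 j)) (ℤP.*-zeroʳ (+ (2 ℕ.^ suc (toℕ j)))))

objective-neg : ∀ {m} (z : Fin m → ℤ) → objective (-_ ∘ z) ≡ - objective z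
objective-neg z = trans
  (∑ℤ-cong (λ j → sym (ℤP.neg-distribʳ-* (+ (2 ℕ.^ suc (toℕ j))) (z j))))
  (∑ℤ-neg (λ j → + (2 ℕ.^ suc (toℕ j)) * z j))

objective-suc : ∀ {m} (z : Fin (suc m) → ℤ) → objective z ≡ + 2 * (z zero + objective (z ∘ suc))
objective-suc z = begin
  + 2 * z zero + ∑ℤ (λ j → + (2 ℕ.* 2 ℕ.^ suc (toℕ j)) * z (suc j))
    ≡⟨ cong (_+_ (+ 2 * z zero)) (∑ℤ-cong λ j → trans
         (cong (_* z (suc j)) (ℤP.pos-* 2 (2 ℕ.^ suc (toℕ j))))
         (ℤP.*-assoc (+ 2) (+ (2 ℕ.^ suc (toℕ j))) (z (suc j)))) ⟩
  + 2 * z zero + ∑ℤ (λ j → + 2 * (+ (2 ℕ.^ suc (toℕ j)) * z (suc j)))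
    ≡⟨ cong (_+_ (+ 2 * z zero)) (∑ℤ-scale (+ 2) (λ j → + (2 ℕ.^ suc (toℕ j)) * z (suc j))) ⟩
  + 2 * z zero + + 2 * objective (z ∘ suc)
    ≡⟨ ℤP.*-distribˡ-+ (+ 2) (z zero) _ ⟨
  + 2 * (z zero + objective (z ∘ suc))
    ∎

objective-even : ∀ {m} (z : Fin m → ℤ) → ∃[ y ] (objective z ≡ + 2 * y)
objective-even {zero}  z = + 0 , refl
objective-even {suc m} z = _ , objective-suc z

x+2y≡0⇒x≡0 : ∀ {x y} → ∣ x ∣ ≤ 1 → x + + 2 * y ≡ + 0 → x ≡ + 0
x+2y≡0⇒x≡0 {x} {y} ∣x∣≤1 x+2y≡0 = trans x≡-2y (cong (λ t → - (+ 2 * t)) y≡0)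
  where
  x≡-2y : x ≡ - (+ 2 * y)
  x≡-2y = inverseˡ-unique x (+ 2 * y) x+2y≡0
  2∣y∣≤1 : 2 ℕ.* ∣ y ∣ ≤ 1
  2∣y∣≤1 = subst (_≤ 1)
    (trans (cong ∣_∣ x≡-2y) (trans (ℤP.∣-i∣≡∣i∣ (+ 2 * y)) (ℤP.abs-* (+ 2) y))) ∣x∣≤1
  2n≤1⇒n≡0 : ∀ {n} → 2 ℕ.* n ≤ 1 → n ≡ 0
  2n≤1⇒n≡0 {zero}  _         = refl
  2n≤1⇒n≡0 {suc n} (s≤s 2n+1≤0) with () ← ℕP.m+n≤o⇒n≤o n 2n+1≤0
  y≡0 : y ≡ + 0
  y≡0 = ℤP.∣i∣≡0⇒i≡0 (2n≤1⇒n≡0 2∣y∣≤1)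

objective≡0⇒≗0 : ∀ {m} (z : Fin m → ℤ) → (∀ j → ∣ z j ∣ ≤ 1) → objective z ≡ + 0 →
                 ∀ j → z j ≡ + 0
objective≡0⇒≗0 {suc m} z ∣z∣≤1 O≡0 = λ
  { zero    → z₀≡0
  ; (suc j) → objective≡0⇒≗0 (z ∘ suc) (∣z∣≤1 ∘ suc) O′≡0 j }
  where
  O′ : ℤ
  O′ = objective (z ∘ suc)
  z₀+O′≡0 : z zero + O′ ≡ + 0
  z₀+O′≡0 = ℤP.*-cancelˡ-≡ (+ 2) _ (+ 0) (trans (sym (objective-suc z)) O≡0)
  z₀≡0 : z zero ≡ + 0
  z₀≡0 = let y , O′≡2y = objective-even (z ∘ suc) in
    x+2y≡0⇒x≡0 (∣z∣≤1 zero) (trans (cong (_+_ (z zero)) (sym O′≡2y)) z₀+O′≡0)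
  O′≡0 : O′ ≡ + 0
  O′≡0 = trans (sym (ℤP.+-identityˡ O′)) (trans (cong (_+ O′) (sym z₀≡0)) z₀+O′≡0)

Minimisable : Set → Set
Minimisable X = (g : X → ℤ) → Σ[ x ∈ X ] (∀ y → g x ℤ.≤ g y)

Fin-minimisable : ∀ n → Minimisable (Fin (suc n))
Fin-minimisable zero    g = zero , λ { zero → ℤP.≤-refl }
Fin-minimisable (suc n) g with Fin-minimisable n (g ∘ suc)
... | x , gx≤ with g zero ℤP.≤? g (suc x)
...   | yes g₀≤gx = zero  , λ { zero → ℤP.≤-refl ; (suc y) → ℤP.≤-trans g₀≤gx (gx≤ y) }
...   | no  g₀≰gx = suc x , λ { zero → ℤP.<⇒≤ (ℤP.≰⇒> g₀≰gx) ; (suc y) → gx≤ y }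

×-minimisable : ∀ {X Y} → Minimisable X → Minimisable Y → Minimisable (X × Y)
×-minimisable {X} {Y} minX minY g =
  let x , gx≤ = minX (λ x → g (x , best x))
  in (x , best x) , λ (x′ , y′) → ℤP.≤-trans (gx≤ x′) (proj₂ (minY (λ y → g (x′ , y))) y′)
  where
  best : X → Y
  best x = proj₁ (minY (λ y → g (x , y)))

Vec-minimisable : ∀ {A} k → Minimisable A → Minimisable (Vec A k)
Vec-minimisable zero    minA g = [] , λ { [] → ℤP.≤-refl }
Vec-minimisable (suc k) minA g =
  let (x , xs) , g≤ = ×-minimisable minA (Vec-minimisable k minA) (λ (x , xs) → g (x ∷ xs))
  in x ∷ xs , λ { (y ∷ ys) → g≤ (y , ys) }

module _ {k a n} (R : Fin n → Vertex k a) where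

  equidistant? : ∀ u v → Dec (Equidistant R u v)
  equidistant? u v = FinP.all? (λ i → hamming u (R i) ℕP.≟ hamming v (R i))

  nonnegative⇒resolving : (∀ z → Feasible R z → + 0 ℤ.≤ objective z) → Resolving R
  nonnegative⇒resolving 0≤obj u v u≢v with equidistant? u v
  ... | no ¬eq = FinP.¬∀⟶∃¬ n _ (λ i → hamming u (R i) ℕP.≟ hamming v (R i)) ¬eq
  ... | yes eq = ⊥-elim (u≢v (diff≡0⇒≡ u v (objective≡0⇒≗0 (diff u v) (∣diff∣≤1 u v) O≡0)))
    where
    O : ℤ
    O = objective (diff u v)
    0≤O : + 0 ℤ.≤ O
    0≤O = 0≤obj (diff u v) (Equivalence.from (diff-feasible⇔equidistant R u v) eq)
    0≤-O : + 0 ℤ.≤ - O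
    0≤-O = subst (+ 0 ℤ.≤_) (trans (objective-cong (diff-swap u v)) (objective-neg (diff u v)))
             (0≤obj (diff v u) (Equivalence.from (diff-feasible⇔equidistant R v u) (sym ∘ eq)))
    O≡0 : O ≡ + 0
    O≡0 = ℤP.≤-antisym (ℤP.neg-cancel-≤ {+ 0} {O} 0≤-O) 0≤O

  optimum-negative : ∀ {m} → IsOptimalValue R m → ¬ Resolving R → m < + 0
  optimum-negative {m} (_ , m≤obj) ¬resolving with m ℤP.<? + 0
  ... | yes m<0 = m<0
  ... | no  m≮0 = ⊥-elim (¬resolving (nonnegative⇒resolving λ z z-feasible →
                    ℤP.≤-trans (ℤP.≮⇒≥ m≮0) (m≤obj z z-feasible)))

module _ {k a n} (R : Fin n → Vertex k (suc a)) where

  feasible⇒equidistant-diff : ∀ z → Feasible R z →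
                              ∃₂ λ u v → z ≗ diff u v × Equidistant R u v
  feasible⇒equidistant-diff z z-feasible =
    let u , v , z≗diff = InI⇒diff z (proj₂ z-feasible)
    in u , v , z≗diff ,
       Equivalence.to (diff-feasible⇔equidistant R u v) (Feasible-resp-≗ R z≗diff z-feasible)

  negative-feasible⇒¬resolving : ∀ {z} → Feasible R z → objective z < + 0 → ¬ Resolving R
  negative-feasible⇒¬resolving {z} z-feasible obj<0 resolving
    with feasible⇒equidistant-diff z z-feasible
  ... | u , v , z≗diff , eq with ≡-dec FinP._≟_ u v
  ...   | yes refl =
    ℤP.<-irrefl (objective-zero (λ j → trans (z≗diff j) (diff-self u j))) obj<0
  ...   | no u≢v = let i , dᵤ≢dᵥ = resolving u v u≢v in dᵤ≢dᵥ (eq i)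

  -- Pairs that are not equidistant get the zero vector diff u u, so that every pair has a
  -- feasible candidate and the minimum over pairs is the minimum over the feasible set.
  candidate : Vertex k (suc a) → Vertex k (suc a) → Fin (k ℕ.* suc a) → ℤ
  candidate u v with equidistant? R u v
  ... | yes _ = diff u v
  ... | no  _ = diff u u

  candidate-feasible : ∀ u v → Feasible R (candidate u v)
  candidate-feasible u v with equidistant? R u v
  ... | yes eq = Equivalence.from (diff-feasible⇔equidistant R u v) eq
  ... | no  _  = Equivalence.from (diff-feasible⇔equidistant R u u) (λ _ → refl)

  candidate-equidistant : ∀ u v → Equidistant R u v → candidate u v ≡ diff u v
  candidate-equidistant u v eq with equidistant? R u v
  ... | yes _   = refl
  ... | no  ¬eq = ⊥-elim (¬eq eq)

  optimum-exists : ∃[ m ] IsOptimalValue R m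
  optimum-exists =
    cost (u* , v*) , (candidate u* v* , candidate-feasible u* v* , refl) , lower-bound
    where
    V = Vertex k (suc a)
    cost : V × V → ℤ
    cost (u , v) = objective (candidate u v)
    minimum : Σ[ p ∈ V × V ] (∀ q → cost p ℤ.≤ cost q)
    minimum = ×-minimisable V-minimisable V-minimisable cost
      where
      V-minimisable : Minimisable V
      V-minimisable = Vec-minimisable k (Fin-minimisable a)
    u* v* : V
    u* = proj₁ (proj₁ minimum)
    v* = proj₂ (proj₁ minimum)
    lower-bound : ∀ z → Feasible R z → cost (u* , v*) ℤ.≤ objective z
    lower-bound z z-feasible =
      let u , v , z≗diff , eq = feasible⇒equidistant-diff z z-feasible
      in ℤP.≤-trans (proj₂ minimum (u , v)) (ℤP.≤-reflexive
           (trans (cong objective (candidate-equidistant u v eq)) (sym (objective-cong z≗diff))))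

theorem4p3 : (k a n : ℕ) → 1 ≤ k → 2 ≤ a → 1 ≤ n →
    (R : Fin n → Vertex k a) →
    (¬ Resolving R) ⇔ (∃[ m ] (IsOptimalValue R m × m < + 0))
theorem4p3 k zero    n _ () _ R
theorem4p3 k (suc a) n _ _  _ R = mk⇔ forward backward
  where
  forward : ¬ Resolving R → ∃[ m ] (IsOptimalValue R m × m < + 0)
  forward ¬resolving =
    let m , optimal = optimum-exists R in m , optimal , optimum-negative R optimal ¬resolving
  backward : ∃[ m ] (IsOptimalValue R m × m < + 0) → ¬ Resolving R
  backward (m , ((z , z-feasible , refl) , _) , m<0) =
    negative-feasible⇒¬resolving R z-feasible m<0
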